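{- Let $T_0,T_1\subseteq\mathbb{Z}_2^\omega$ be two thin sets such that $T_0\cup T_1=\mathbb{Z}_2^\omega$. Then $T_0$ and $T_1$ are disjoint, and both are xor-sets.
   Context: $\omega=\{0,1,2,\dots\}$; $\mathbb{Z}_2^\omega$ is the set of infinite binary sequences. For $n\in\omega$ let $\mathrm{pr}_n(x):=x|_{\omega\setminus\{n\}}$; a set $T\subseteq\mathbb{Z}_2^\omega$ is thin if for each $n\in\omega$ the restriction $\mathrm{pr}_n|_T$ is injective. For $x\in\mathbb{Z}_2^\omega$ and $n\in\omega$, $x^{\#n}$ denotes the sequence obtained from $x$ by flipping the $n$-th bit ($x^{\#n}(k)=x(k)$ for $k\ne n$, $x^{\#n}(n)=1-x(n)$). A set $S\subseteq\mathbb{Z}_2^\omega$ is a xor-set if for every $n\in\omega$ and every $x\in\mathbb{Z}_2^\omega$: $x\in S \iff x^{\#n}\notin S$. -}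

module Defs where

open import Data.Nat using (ℕ)
open import Data.Bool using (Bool; not)
open import Data.Product using (_×_)
open import Data.Empty using (⊥)
open import Relation.Nullary using (¬_)
open import Relation.Binary.PropositionalEquality using (_≡_; _≢_)
open import Relation.Nullary.Decidable using (⌊_⌋)
open import Data.Nat using (_≟_)
open import Function.Bundles using (_⇔_)

-- ℤ₂^ω : infinite binary sequences
Seq : Set
Seq = ℕ → Bool

Subset : Set₁
Subset = Seq → Set

_≐_ : Seq → Seq → Set
x ≐ y = ∀ k → x k ≡ y k

-- pr_n(x) = pr_n(y) : x and y agree on ω ∖ {n}
AgreeOff : ℕ → Seq → Seq → Set
AgreeOff n x y = ∀ k → k ≢ n → x k ≡ y k

Thin : Subset → Set
Thin T = ∀ n x y → T x → T y → AgreeOff n x y → x ≐ y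

flipAt : ℕ → Seq → Seq
flipAt n x k with k ≟ n
... | Relation.Nullary.yes _ = not (x k)
... | Relation.Nullary.no _ = x k

XorSet : Subset → Set
XorSet S = ∀ n x → S x ⇔ (¬ S (flipAt n x))

Disjoint : Subset → Subset → Set
Disjoint A B = ∀ x → ¬ (A x × B x)

{-# OPTIONS --safe #-}
module Submission where

-- A thin set never contains both x and x^{#n}, since they agree off n but
-- differ at n. Hence if T₀ ∪ T₁ covers everything, then for x ∈ T₀ its flip
-- x^{#n} lies in T₁ and not in T₀; and if x ∉ T₀, then x ∈ T₁, so x^{#n} ∉ T₁
-- and therefore x^{#n} ∈ T₀. Disjointness follows the same way: if x ∈ T₀ ∩ T₁,
-- then x^{#0} lies in one of the two thin sets together with x.

open import Defs
open import Data.Sum using (_⊎_; inj₁; inj₂; swap)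
open import Data.Product using (_×_; _,_)
open import Data.Nat using (_≟_)
open import Data.Bool.Properties using (not-¬)
open import Data.Empty using (⊥-elim)
open import Relation.Nullary using (yes; no; ¬_)
open import Relation.Binary.PropositionalEquality using (refl; _≢_)
open import Function.Bundles using (mk⇔)

flipAt-agreeOff : ∀ n x → AgreeOff n x (flipAt n x)
flipAt-agreeOff n x k k≢n with k ≟ n
... | yes k≡n = ⊥-elim (k≢n k≡n)
... | no _    = refl

flipAt-differs : ∀ n x → x n ≢ flipAt n x n
flipAt-differs n x with n ≟ n
... | yes _   = not-¬ refl
... | no n≢n = ⊥-elim (n≢n refl)

Thin⇒¬flipPair : ∀ {T} → Thin T → ∀ n x → T x → ¬ T (flipAt n x)
Thin⇒¬flipPair thin n x Tx Tx′ =
  flipAt-differs n x (thin n x (flipAt n x) Tx Tx′ (flipAt-agreeOff n x) n)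

thinCover⇒XorSet : ∀ {T T′} → Thin T → Thin T′ → (∀ x → T x ⊎ T′ x) → XorSet T
thinCover⇒XorSet {T} {T′} thin thin′ cover n x =
  mk⇔ (Thin⇒¬flipPair thin n x) flipOutside⇒inside
  where
  flipOutside⇒inside : ¬ T (flipAt n x) → T x
  flipOutside⇒inside ¬Tx′ with cover x | cover (flipAt n x)
  ... | inj₁ Tx  | _         = Tx
  ... | inj₂ _   | inj₁ Tx′  = ⊥-elim (¬Tx′ Tx′)
  ... | inj₂ T′x | inj₂ T′x′ = ⊥-elim (Thin⇒¬flipPair thin′ n x T′x T′x′)

thinCover⇒Disjoint : ∀ {T T′} → Thin T → Thin T′ → (∀ x → T x ⊎ T′ x) → Disjoint T T′
thinCover⇒Disjoint thin thin′ cover x (Tx , T′x) with cover (flipAt 0 x)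
... | inj₁ Tx′  = Thin⇒¬flipPair thin 0 x Tx Tx′
... | inj₂ T′x′ = Thin⇒¬flipPair thin′ 0 x T′x T′x′

mainTheorem12 : (T₀ T₁ : Subset) → Thin T₀ → Thin T₁
                  → (∀ x → T₀ x ⊎ T₁ x)
                  → Disjoint T₀ T₁ × XorSet T₀ × XorSet T₁
mainTheorem12 T₀ T₁ thin₀ thin₁ cover =
    thinCover⇒Disjoint thin₀ thin₁ cover
  , thinCover⇒XorSet thin₀ thin₁ cover
  , thinCover⇒XorSet thin₁ thin₀ (λ x → swap (cover x))
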